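{- Let $n,k$ be integers with $0<k<n/2$ such that $G(n,k)$ is not bipartite, and let $g$ be its odd girth. Then every cycle of length $g$ in $G(n,k)$ contains at most two spokes.
   Context: $G(n,k)$ has outer vertices $u_0,\dots,u_{n-1}$, inner vertices $v_0,\dots,v_{n-1}$ and edges $u_iu_{i+1}$, $v_iv_{i+k}$ and spokes $u_iv_i$ (indices mod $n$). The odd girth is the length of a shortest odd cycle. -}

module Defs where

open import Data.Nat using (ℕ; zero; suc; _+_; _*_; _≤_; _<_; _%_)
open import Data.Nat.DivMod using (m%n<n)
open import Data.Fin using (Fin; toℕ; fromℕ<)
open import Data.Bool using (Bool; true; false; if_then_else_; _xor_)
open import Data.Product using (Σ; _×_; _,_; proj₁; ∃-syntax)
open import Data.Sum using (_⊎_)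
open import Data.List using (List; map; allFin)
open import Data.Nat.ListAction using (sum)
open import Relation.Binary.PropositionalEquality using (_≡_; _≢_)
open import Relation.Nullary using (¬_)
open import Function.Definitions using (Injective)

-- Vertices of G(n,k): (false , i) is the outer vertex u_i,
-- (true , i) is the inner vertex v_i.
V : ℕ → Set
V n = Bool × Fin n

u : ∀ {n} → Fin n → V n
u i = false , i

v : ∀ {n} → Fin n → V n
v i = true , i

ShiftBy : (n s : ℕ) → Fin n → Fin n → Set
ShiftBy n s i j = ∃[ q ] toℕ i + s ≡ q * n + toℕ j

data Edge (n k : ℕ) : V n → V n → Set where
  outer : ∀ {i j} → ShiftBy n 1 i j → Edge n k (u i) (u j)
  inner : ∀ {i j} → ShiftBy n k i j → Edge n k (v i) (v j)
  spoke : ∀ {i} → Edge n k (u i) (v i)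

Adj : (n k : ℕ) → V n → V n → Set
Adj n k x y = Edge n k x y ⊎ Edge n k y x

Bipartite : (n k : ℕ) → Set
Bipartite n k = Σ (V n → Bool) λ f → ∀ x y → Adj n k x y → f x ≢ f y

csuc : ∀ {L} → Fin L → Fin L
csuc {suc m} i = fromℕ< (m%n<n (suc (toℕ i)) (suc m))

record Cycle (n k L : ℕ) : Set where
  field
    len≥3 : 3 ≤ L
    vert  : Fin L → V n
    inj   : Injective _≡_ _≡_ vert
    adj   : ∀ i → Adj n k (vert i) (vert (csuc i))

open Cycle public

-- number of edges c_i c_{i+1} of the cycle that are spokes
-- (i.e. join an outer and an inner vertex)
spokeCount : ∀ {n k L} → Cycle n k L → ℕ
spokeCount {L = L} c =
  sum (map (λ i → if proj₁ (vert c i) xor proj₁ (vert c (csuc i)) then 1 else 0) (allFin L))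

Odd : ℕ → Set
Odd m = ∃[ q ] m ≡ suc (2 * q)

IsOddGirth : (n k g : ℕ) → Set
IsOddGirth n k g =
  Odd g × Cycle n k g × (∀ L → Odd L → Cycle n k L → g ≤ L)

{-# OPTIONS --safe #-}
-- Along any cycle of G(n,k) the side (outer or inner) changes an even number of times, so an odd
-- cycle with more than two spokes has at least four. Where the index ends up modulo n depends only
-- on the multiset of steps: taking all outer steps first, then a spoke, then all inner steps, then
-- a spoke back, gives a closed walk of the same odd parity and at least two edges shorter. An odd
-- closed walk contains an odd cycle no longer than itself (split it at a repeated vertex and keep an
-- odd part), contradicting the minimality of the odd girth.
module Submission where

open import Defs
open import Data.Nat using (ℕ; zero; suc; _+_; _*_; _∸_; _≤_; _<_; z≤n; s≤s; NonZero; >-nonZero⁻¹; _%_; _/_; _≤?_)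
open import Data.Nat.Properties
open import Data.Nat.DivMod
open import Data.Nat.Divisibility using (_∣_; divides; n∣m⇒m%n≡0)
open import Data.Nat.Induction using (<-rec)
open import Data.Fin as Fin using (Fin; toℕ)
open import Data.Fin.Properties using (toℕ-fromℕ<; toℕ-injective; toℕ<n; toℕ-inject₁; toℕ-fromℕ)
open import Data.Bool using (Bool; true; false; not; _xor_; _∧_; if_then_else_)
import Data.Bool.Properties as Bool
open import Data.Product using (_×_; _,_; proj₁; proj₂; ∃-syntax)
open import Data.Product.Properties using (≡-dec)
open import Data.Sum using (_⊎_; inj₁; inj₂)
open import Data.Empty using (⊥; ⊥-elim)
open import Data.Unit using (⊤; tt)
open import Data.List using (List; []; _∷_; _++_; length; tabulate; map)
open import Data.List.Properties using (length-++; map-++; map-tabulate; tabulate-cong; length-tabulate)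
open import Data.Nat.ListAction using (sum)
open import Data.Nat.ListAction.Properties using (sum-++)
open import Algebra.Properties.CommutativeSemigroup +-commutativeSemigroup using (x∙yz≈y∙xz)
open import Relation.Binary using (tri<; tri≈; tri>)
open import Relation.Binary.PropositionalEquality
open import Relation.Nullary using (¬_; Dec; yes; no; contradiction)
open import Data.Nat.Tactic.RingSolver using (solve-∀)
open import Algebra.Properties.Semiring.Sum +-*-semiring
  using (∑-distrib-+; *-distribʳ-sum; *-distribˡ-sum; sum-cong-≗; sum-init-last)
  renaming (sum to ∑)

Even : ℕ → Set
Even m = ∃[ q ] m ≡ 2 * q

even⊎odd : ∀ m → Even m ⊎ Odd m
even⊎odd zero = inj₁ (0 , refl)
even⊎odd (suc m) with even⊎odd m
... | inj₁ (q , refl) = inj₂ (q , refl)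
... | inj₂ (q , refl) = inj₁ (suc q , sym (*-suc 2 q))

odd-+-even : ∀ a s → Odd (a + s) → Even s → Odd a
odd-+-even a s (r , a+s≡odd) (q , refl) with even⊎odd a
... | inj₂ odd = odd
... | inj₁ (p , refl) = contradiction (trans (*-distribˡ-+ 2 p q) a+s≡odd) (even≢odd (p + q) r)

odd-2+ : ∀ {a} → Odd a → Odd (2 + a)
odd-2+ (q , refl) = suc q , cong suc (sym (*-suc 2 q))

odd-+ : ∀ a b → Odd (a + b) → Odd a ⊎ Odd b
odd-+ a b odd with even⊎odd b
... | inj₁ even = inj₁ (odd-+-even a b odd even)
... | inj₂ odd-b = inj₂ odd-b

toℕ-csuc : ∀ {m} (i : Fin (suc m)) → toℕ (csuc i) ≡ suc (toℕ i) % suc m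
toℕ-csuc {m} i = toℕ-fromℕ< (m%n<n (suc (toℕ i)) (suc m))

csuc-inject₁ : ∀ {m} (i : Fin m) → csuc (Fin.inject₁ i) ≡ Fin.suc i
csuc-inject₁ {m} i = toℕ-injective (begin
  toℕ (csuc (Fin.inject₁ i))         ≡⟨ toℕ-csuc (Fin.inject₁ i) ⟩
  suc (toℕ (Fin.inject₁ i)) % suc m ≡⟨ cong (λ x → suc x % suc m) (toℕ-inject₁ i) ⟩
  suc (toℕ i) % suc m               ≡⟨ m<n⇒m%n≡m (s≤s (toℕ<n i)) ⟩
  suc (toℕ i)                       ∎)
  where open ≡-Reasoning

csuc-fromℕ : ∀ m → csuc (Fin.fromℕ m) ≡ Fin.zero
csuc-fromℕ m = toℕ-injective (begin
  toℕ (csuc (Fin.fromℕ m))         ≡⟨ toℕ-csuc (Fin.fromℕ m) ⟩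
  suc (toℕ (Fin.fromℕ m)) % suc m ≡⟨ cong (λ x → suc x % suc m) (toℕ-fromℕ m) ⟩
  suc m % suc m                   ≡⟨ n%n≡0 (suc m) ⟩
  0                               ∎)
  where open ≡-Reasoning

∑-rotate : ∀ {m} (f : Fin m → ℕ) → ∑ (λ i → f (csuc i)) ≡ ∑ f
∑-rotate {zero} f = refl
∑-rotate {suc m} f = begin
  ∑ (λ i → f (csuc i))
    ≡⟨ sum-init-last (λ i → f (csuc i)) ⟩
  ∑ (λ i → f (csuc (Fin.inject₁ i))) + f (csuc (Fin.fromℕ m))
    ≡⟨ cong₂ _+_ (sum-cong-≗ (λ i → cong f (csuc-inject₁ i))) (cong f (csuc-fromℕ m)) ⟩
  ∑ (λ i → f (Fin.suc i)) + f Fin.zero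
    ≡⟨ +-comm _ (f Fin.zero) ⟩
  ∑ f
    ∎
  where open ≡-Reasoning

sum-tabulate : ∀ {m} (f : Fin m → ℕ) → sum (tabulate f) ≡ ∑ f
sum-tabulate {zero} f = refl
sum-tabulate {suc m} f = cong (f Fin.zero +_) (sum-tabulate (λ i → f (Fin.suc i)))

indicator : Bool → ℕ
indicator b = if b then 1 else 0

∑-changes-even : ∀ {m} (l : Fin m → Bool) → Even (∑ (λ i → indicator (l i xor l (csuc i))))
∑-changes-even l = ∑ down , +-cancelˡ-≡ (∑ here) _ _ (begin
  ∑ here + ∑ change                      ≡⟨ sym (∑-distrib-+ here change) ⟩
  ∑ (λ i → here i + change i)            ≡⟨ sum-cong-≗ (λ i → sym (changes (l i) (l (csuc i)))) ⟩
  ∑ (λ i → next i + 2 * down i)          ≡⟨ ∑-distrib-+ next (λ i → 2 * down i) ⟩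
  ∑ next + ∑ (λ i → 2 * down i)          ≡⟨ cong₂ _+_ (∑-rotate here) (sym (*-distribˡ-sum 2 down)) ⟩
  ∑ here + 2 * ∑ down                    ∎)
  where
  open ≡-Reasoning
  here next change down : Fin _ → ℕ
  here i = indicator (l i)
  next i = indicator (l (csuc i))
  change i = indicator (l i xor l (csuc i))
  down i = indicator (l i ∧ (l i xor l (csuc i)))
  changes : ∀ a b → indicator b + 2 * indicator (a ∧ (a xor b)) ≡ indicator a + indicator (a xor b)
  changes false false = refl
  changes false true = refl
  changes true false = refl
  changes true true = refl

∑-shifts-divisible : ∀ {m n} (t : Fin m → Fin n) (a : Fin m → ℕ) →
  (∀ i → ShiftBy n (a i) (t i) (t (csuc i))) → n ∣ ∑ a
∑-shifts-divisible {n = n} t a shifted = divides (∑ q) (+-cancelˡ-≡ (∑ t′) _ _ (begin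
  ∑ t′ + ∑ a                          ≡⟨ sym (∑-distrib-+ t′ a) ⟩
  ∑ (λ i → t′ i + a i)                ≡⟨ sum-cong-≗ (λ i → proj₂ (shifted i)) ⟩
  ∑ (λ i → q i * n + t′ (csuc i))     ≡⟨ ∑-distrib-+ (λ i → q i * n) (λ i → t′ (csuc i)) ⟩
  ∑ (λ i → q i * n) + ∑ (λ i → t′ (csuc i)) ≡⟨ cong₂ _+_ (sym (*-distribʳ-sum n q)) (∑-rotate t′) ⟩
  ∑ q * n + ∑ t′                      ≡⟨ +-comm _ (∑ t′) ⟩
  ∑ t′ + ∑ q * n                      ∎))
  where
  open ≡-Reasoning
  t′ : Fin _ → ℕ
  t′ i = toℕ (t i)
  q : Fin _ → ℕ
  q i = proj₁ (shifted i)

module _ {n : ℕ} .{{_ : NonZero n}} where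

  [m%n+o]%n≡[m+o]%n : ∀ m o → (m % n + o) % n ≡ (m + o) % n
  [m%n+o]%n≡[m+o]%n m o = begin
    (m % n + o) % n            ≡⟨ %-distribˡ-+ (m % n) o n ⟩
    (m % n % n + o % n) % n    ≡⟨ cong (λ x → (x + o % n) % n) (m%n%n≡m%n m n) ⟩
    (m % n + o % n) % n        ≡⟨ %-distribˡ-+ m o n ⟨
    (m + o) % n                ∎
    where open ≡-Reasoning

  ShiftBy⇒≡% : ∀ {s} {i j : Fin n} → ShiftBy n s i j → toℕ j ≡ (toℕ i + s) % n
  ShiftBy⇒≡% {s} {i} {j} (q , i+s≡q*n+j) = sym (begin
    (toℕ i + s) % n      ≡⟨ cong (_% n) (trans i+s≡q*n+j (+-comm (q * n) (toℕ j))) ⟩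
    (toℕ j + q * n) % n  ≡⟨ [m+kn]%n≡m%n (toℕ j) q n ⟩
    toℕ j % n            ≡⟨ m<n⇒m%n≡m (toℕ<n j) ⟩
    toℕ j                ∎)
    where open ≡-Reasoning

  ≡%⇒ShiftBy : ∀ {s} {i j : Fin n} → toℕ j ≡ (toℕ i + s) % n → ShiftBy n s i j
  ≡%⇒ShiftBy {s} {i} {j} j≡i+s = (toℕ i + s) / n , (begin
    toℕ i + s                              ≡⟨ m≡m%n+[m/n]*n (toℕ i + s) n ⟩
    (toℕ i + s) % n + (toℕ i + s) / n * n  ≡⟨ +-comm _ ((toℕ i + s) / n * n) ⟩
    (toℕ i + s) / n * n + (toℕ i + s) % n  ≡⟨ cong ((toℕ i + s) / n * n +_) j≡i+s ⟨
    (toℕ i + s) / n * n + toℕ j            ∎)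
    where open ≡-Reasoning

  mod-ShiftBy : ∀ {a b} s → (a + s) % n ≡ b % n → ShiftBy n s (a mod n) (b mod n)
  mod-ShiftBy {a} {b} s a+s≡b = ≡%⇒ShiftBy {s} {a mod n} (begin
    toℕ (b mod n)               ≡⟨ toℕ-fromℕ< (m%n<n b n) ⟩
    b % n                       ≡⟨ a+s≡b ⟨
    (a + s) % n                 ≡⟨ [m%n+o]%n≡[m+o]%n a s ⟨
    (a % n + s) % n             ≡⟨ cong (λ x → (x + s) % n) (toℕ-fromℕ< (m%n<n a n)) ⟨
    (toℕ (a mod n) + s) % n     ∎)
    where open ≡-Reasoning

  ShiftBy-reverse : ∀ {s} {i j : Fin n} → s ≤ n → ShiftBy n s j i → ShiftBy n (n ∸ s) i j
  ShiftBy-reverse {s} {i} {j} s≤n j+s≡i = ≡%⇒ShiftBy {n ∸ s} {i} (sym (begin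
    (toℕ i + (n ∸ s)) % n             ≡⟨ cong (λ x → (x + (n ∸ s)) % n) (ShiftBy⇒≡% {s} {j} j+s≡i) ⟩
    ((toℕ j + s) % n + (n ∸ s)) % n   ≡⟨ [m%n+o]%n≡[m+o]%n (toℕ j + s) (n ∸ s) ⟩
    (toℕ j + s + (n ∸ s)) % n         ≡⟨ cong (_% n) (+-assoc (toℕ j) s (n ∸ s)) ⟩
    (toℕ j + (s + (n ∸ s))) % n       ≡⟨ cong (λ x → (toℕ j + x) % n) (m+[n∸m]≡n s≤n) ⟩
    (toℕ j + n) % n                   ≡⟨ [m+n]%n≡m%n (toℕ j) n ⟩
    toℕ j % n                         ≡⟨ m<n⇒m%n≡m (toℕ<n j) ⟩
    toℕ j                             ∎))
    where open ≡-Reasoning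

ShiftBy-irrefl : ∀ {n s} {i : Fin n} → 0 < s → s < n → ¬ ShiftBy n s i i
ShiftBy-irrefl {n} {s} {i} 0<s s<n (q , i+s≡q*n+i) = multiple q s≡q*n
  where
  s≡q*n : s ≡ q * n
  s≡q*n = +-cancelˡ-≡ (toℕ i) s (q * n) (trans i+s≡q*n+i (+-comm (q * n) (toℕ i)))
  multiple : ∀ q → s ≡ q * n → ⊥
  multiple zero s≡0 = <-irrefl (sym s≡0) 0<s
  multiple (suc q) s≡n+q*n = <⇒≱ s<n (subst (n ≤_) (sym s≡n+q*n) (m≤m+n n (q * n)))

ClosedWalk : (n k m : ℕ) → (ℕ → V n) → Set
ClosedWalk n k m w = w m ≡ w 0 × (∀ j → j < m → Adj n k (w j) (w (suc j)))

Repeats : ∀ {n} → ℕ → (ℕ → V n) → Set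
Repeats m w = ∃[ j ] j < m × ∃[ i ] i < j × w i ≡ w j

repeats? : ∀ {n} m (w : ℕ → V n) → Dec (Repeats m w)
repeats? m w = anyUpTo? (λ j → anyUpTo? (λ i → ≡-dec Bool._≟_ Fin._≟_ (w i) (w j)) j) m

ClosedWalk-wrap : ∀ {n k m w j} → ClosedWalk n k (suc m) w → j ≤ suc m → w (j % suc m) ≡ w j
ClosedWalk-wrap {m = m} {w} {j} (closed , _) j≤m with m≤n⇒m<n∨m≡n j≤m
... | inj₁ j<m = cong w (m<n⇒m%n≡m j<m)
... | inj₂ refl = trans (cong w (n%n≡0 (suc m))) (sym closed)

-- Follows w up to index i and then runs d indices ahead; when w i ≡ w (i + d) this cuts out
-- the closed subwalk between them.
bypass : ∀ {n} → ℕ → ℕ → (ℕ → V n) → ℕ → V n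
bypass i d w t with t ≤? i
... | yes _ = w t
... | no _ = w (t + d)

bypass-≤ : ∀ {n} i d (w : ℕ → V n) {t} → t ≤ i → bypass i d w t ≡ w t
bypass-≤ i d w {t} t≤i with t ≤? i
... | yes _ = refl
... | no t≰i = contradiction t≤i t≰i

bypass-> : ∀ {n} i d (w : ℕ → V n) {t} → i < t → bypass i d w t ≡ w (t + d)
bypass-> i d w {t} i<t with t ≤? i
... | yes t≤i = contradiction t≤i (<⇒≱ i<t)
... | no _ = refl

module _ {n k : ℕ} (i d e : ℕ) (w : ℕ → V n) (repeat : w i ≡ w (suc (i + d)))
         (cw : ClosedWalk n k (suc (suc (i + d)) + e) w) where

  loop-closed : ClosedWalk n k (suc d) (λ t → w (i + t))
  loop-closed = returns , adjacent
    where
    returns : w (i + suc d) ≡ w (i + 0)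
    returns = trans (cong w (+-suc i d)) (trans (sym repeat) (cong w (sym (+-identityʳ i))))
    adjacent : ∀ t → t < suc d → Adj n k (w (i + t)) (w (i + suc t))
    adjacent t (s≤s t≤d) = subst (λ x → Adj n k (w (i + t)) (w x)) (sym (+-suc i t))
      (proj₂ cw (i + t) (s≤s (≤-trans (+-monoʳ-≤ i t≤d) (≤-trans (n≤1+n (i + d)) (m≤m+n (suc (i + d)) e)))))

  bypass-closed : ClosedWalk n k (i + suc e) (bypass i (suc d) w)
  bypass-closed = returns , adjacent
    where
    length≡ : i + suc e + suc d ≡ suc (suc (i + d)) + e
    length≡ = rearrange i d e
      where
      rearrange : ∀ i d e → i + suc e + suc d ≡ suc (suc (i + d)) + e
      rearrange = solve-∀
    returns : bypass i (suc d) w (i + suc e) ≡ bypass i (suc d) w 0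
    returns = begin
      bypass i (suc d) w (i + suc e) ≡⟨ bypass-> i (suc d) w (subst (i <_) (sym (+-suc i e)) (s≤s (m≤m+n i e))) ⟩
      w (i + suc e + suc d)          ≡⟨ cong w length≡ ⟩
      w (suc (suc (i + d)) + e)      ≡⟨ proj₁ cw ⟩
      w 0                            ≡⟨ bypass-≤ i (suc d) w z≤n ⟨
      bypass i (suc d) w 0           ∎
      where open ≡-Reasoning
    adjacent : ∀ t → t < i + suc e → Adj n k (bypass i (suc d) w t) (bypass i (suc d) w (suc t))
    adjacent t t<i+1+e with <-cmp t i
    ... | tri< t<i _ _ rewrite bypass-≤ i (suc d) w (<⇒≤ t<i) | bypass-≤ i (suc d) w t<i =
      proj₂ cw t (<-trans t<i (s≤s (≤-trans (m≤m+n i d) (≤-trans (n≤1+n (i + d)) (m≤m+n (suc (i + d)) e)))))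
    ... | tri≈ _ refl _
      rewrite bypass-≤ i (suc d) w (≤-refl {t}) | bypass-> i (suc d) w (n<1+n t) | repeat | +-suc t d =
      proj₂ cw (suc (t + d)) (s≤s (s≤s (m≤m+n (t + d) e)))
    ... | tri> _ _ i<t rewrite bypass-> i (suc d) w i<t | bypass-> i (suc d) w (<-trans i<t (n<1+n t)) =
      proj₂ cw (t + suc d) (subst (t + suc d <_) length≡ (+-monoˡ-< (suc d) t<i+1+e))

OddCycleWithin : (n k m : ℕ) → Set
OddCycleWithin n k m = ∃[ L ] Odd L × L ≤ m × Cycle n k L

OddCycleWithin-mono : ∀ {n k m′ m} → m′ ≤ m → OddCycleWithin n k m′ → OddCycleWithin n k m
OddCycleWithin-mono m′≤m (L , odd , L≤m′ , cycle) = L , odd , ≤-trans L≤m′ m′≤m , cycle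

module _ {n k : ℕ} (loopless : ∀ x → ¬ Adj n k x x) where

  closedWalk⇒cycle : ∀ {m w} → Odd m → ClosedWalk n k m w → ¬ Repeats m w → Cycle n k m
  closedWalk⇒cycle {w = w} (zero , refl) (returns , adjacent) _ =
    ⊥-elim (loopless (w 0) (subst (Adj n k (w 0)) returns (adjacent 0 (s≤s z≤n))))
  closedWalk⇒cycle {w = w} (suc q , refl) cw@(_ , adjacent) distinct = record
    { len≥3 = s≤s (*-monoʳ-≤ 2 (s≤s (z≤n {q})))
    ; vert = λ i → w (toℕ i)
    ; inj = injective
    ; adj = λ i → subst (Adj n k (w (toℕ i))) (next i) (adjacent (toℕ i) (toℕ<n i))
    }
    where
    injective : ∀ {i j} → w (toℕ i) ≡ w (toℕ j) → i ≡ j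
    injective {i} {j} wi≡wj with <-cmp (toℕ i) (toℕ j)
    ... | tri< i<j _ _ = contradiction (toℕ j , toℕ<n j , toℕ i , i<j , wi≡wj) distinct
    ... | tri≈ _ i≡j _ = toℕ-injective i≡j
    ... | tri> _ _ j<i = contradiction (toℕ i , toℕ<n i , toℕ j , j<i , sym wi≡wj) distinct
    next : ∀ i → w (suc (toℕ i)) ≡ w (toℕ (csuc i))
    next i = trans (sym (ClosedWalk-wrap cw (toℕ<n i))) (cong w (sym (toℕ-csuc i)))

  oddCycleWithin : ∀ m → Odd m → ∀ w → ClosedWalk n k m w → OddCycleWithin n k m
  oddCycleWithin = <-rec _ extract
    where
    extract : ∀ m → (∀ {m′} → m′ < m → Odd m′ → ∀ w → ClosedWalk n k m′ w → OddCycleWithin n k m′) →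
              Odd m → ∀ w → ClosedWalk n k m w → OddCycleWithin n k m
    extract m shorter odd w cw with repeats? m w
    ... | no distinct = m , odd , ≤-refl , closedWalk⇒cycle odd cw distinct
    ... | yes (j , j<m , i , i<j , repeat) with m≤n⇒∃[o]m+o≡n i<j | m≤n⇒∃[o]m+o≡n j<m
    ...   | d , refl | e , refl = shorten (odd-+ (suc d) (i + suc e) (subst Odd (sym lengths) odd))
      where
      lengths : suc d + (i + suc e) ≡ suc (suc (i + d)) + e
      lengths = rearrange i d e
        where
        rearrange : ∀ i d e → suc d + (i + suc e) ≡ suc (suc (i + d)) + e
        rearrange = solve-∀
      loop<m : suc d < suc (suc (i + d)) + e
      loop<m = subst (suc d <_) lengths (m<m+n (suc d) (subst (0 <_) (sym (+-suc i e)) (s≤s z≤n)))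
      bypass<m : i + suc e < suc (suc (i + d)) + e
      bypass<m = subst (i + suc e <_) (trans (+-comm (i + suc e) (suc d)) lengths) (m<m+n (i + suc e) (s≤s z≤n))
      shorten : Odd (suc d) ⊎ Odd (i + suc e) → OddCycleWithin n k (suc (suc (i + d)) + e)
      shorten (inj₁ odd-loop) =
        OddCycleWithin-mono (<⇒≤ loop<m) (shorter loop<m odd-loop _ (loop-closed i d e w repeat cw))
      shorten (inj₂ odd-bypass) =
        OddCycleWithin-mono (<⇒≤ bypass<m) (shorter bypass<m odd-bypass _ (bypass-closed i d e w repeat cw))

Adj-irrefl : ∀ {n k} → 0 < k → k < n → 1 < n → ∀ x → ¬ Adj n k x x
Adj-irrefl 0<k k<n 1<n _ (inj₁ (outer loop)) = ShiftBy-irrefl (s≤s z≤n) 1<n loop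
Adj-irrefl 0<k k<n 1<n _ (inj₂ (outer loop)) = ShiftBy-irrefl (s≤s z≤n) 1<n loop
Adj-irrefl 0<k k<n 1<n _ (inj₁ (inner loop)) = ShiftBy-irrefl 0<k k<n loop
Adj-irrefl 0<k k<n 1<n _ (inj₂ (inner loop)) = ShiftBy-irrefl 0<k k<n loop

-- outer⁺ traverses u_i u_{i+1} forwards and outer⁻ backwards, inner⁺ and inner⁻ likewise v_i v_{i+k},
-- and across is a spoke in either direction.
data Step : Set where
  outer⁺ outer⁻ inner⁺ inner⁻ across : Step

turn : Step → Bool → Bool
turn across b = not b
turn _ b = b

Legal : Bool → Step → Set
Legal false outer⁺ = ⊤
Legal false outer⁻ = ⊤
Legal true inner⁺ = ⊤
Legal true inner⁻ = ⊤
Legal _ across = ⊤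
Legal _ _ = ⊥

Walkable : Bool → List Step → Bool → Set
Walkable b [] b′ = b ≡ b′
Walkable b (s ∷ ss) b′ = Legal b s × Walkable (turn s b) ss b′

Walkable-++ : ∀ {b b′ b″} xs {ys} → Walkable b xs b′ → Walkable b′ ys b″ → Walkable b (xs ++ ys) b″
Walkable-++ [] refl walkable-ys = walkable-ys
Walkable-++ (_ ∷ xs) (legal , walkable-xs) walkable-ys = legal , Walkable-++ xs walkable-xs walkable-ys

outerSteps innerSteps : List Step → List Step
outerSteps [] = []
outerSteps (outer⁺ ∷ ss) = outer⁺ ∷ outerSteps ss
outerSteps (outer⁻ ∷ ss) = outer⁻ ∷ outerSteps ss
outerSteps (_ ∷ ss) = outerSteps ss
innerSteps [] = []
innerSteps (inner⁺ ∷ ss) = inner⁺ ∷ innerSteps ss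
innerSteps (inner⁻ ∷ ss) = inner⁻ ∷ innerSteps ss
innerSteps (_ ∷ ss) = innerSteps ss

Walkable-outerSteps : ∀ ss → Walkable false (outerSteps ss) false
Walkable-outerSteps [] = refl
Walkable-outerSteps (outer⁺ ∷ ss) = tt , Walkable-outerSteps ss
Walkable-outerSteps (outer⁻ ∷ ss) = tt , Walkable-outerSteps ss
Walkable-outerSteps (inner⁺ ∷ ss) = Walkable-outerSteps ss
Walkable-outerSteps (inner⁻ ∷ ss) = Walkable-outerSteps ss
Walkable-outerSteps (across ∷ ss) = Walkable-outerSteps ss

Walkable-innerSteps : ∀ ss → Walkable true (innerSteps ss) true
Walkable-innerSteps [] = refl
Walkable-innerSteps (outer⁺ ∷ ss) = Walkable-innerSteps ss
Walkable-innerSteps (outer⁻ ∷ ss) = Walkable-innerSteps ss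
Walkable-innerSteps (inner⁺ ∷ ss) = tt , Walkable-innerSteps ss
Walkable-innerSteps (inner⁻ ∷ ss) = tt , Walkable-innerSteps ss
Walkable-innerSteps (across ∷ ss) = Walkable-innerSteps ss

twoSpokeSteps : List Step → List Step
twoSpokeSteps ss = outerSteps ss ++ across ∷ innerSteps ss ++ across ∷ []

Walkable-twoSpokeSteps : ∀ ss → Walkable false (twoSpokeSteps ss) false
Walkable-twoSpokeSteps ss = Walkable-++ (outerSteps ss) (Walkable-outerSteps ss)
  (tt , Walkable-++ (innerSteps ss) (Walkable-innerSteps ss) (tt , refl))

crossing : Step → ℕ
crossing across = 1
crossing _ = 0

spokes : List Step → ℕ
spokes ss = sum (map crossing ss)

length-partition : ∀ ss → length (outerSteps ss) + length (innerSteps ss) + spokes ss ≡ length ss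
length-partition [] = refl
length-partition (outer⁺ ∷ ss) = cong suc (length-partition ss)
length-partition (outer⁻ ∷ ss) = cong suc (length-partition ss)
length-partition (inner⁺ ∷ ss) =
  trans (cong (_+ spokes ss) (+-suc (length (outerSteps ss)) _)) (cong suc (length-partition ss))
length-partition (inner⁻ ∷ ss) =
  trans (cong (_+ spokes ss) (+-suc (length (outerSteps ss)) _)) (cong suc (length-partition ss))
length-partition (across ∷ ss) = trans (+-suc _ (spokes ss)) (cong suc (length-partition ss))

length-twoSpokeSteps : ∀ ss → length (twoSpokeSteps ss) ≡ 2 + (length (outerSteps ss) + length (innerSteps ss))
length-twoSpokeSteps ss = begin
  length (outerSteps ss ++ across ∷ innerSteps ss ++ across ∷ []) ≡⟨ length-++ (outerSteps ss) ⟩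
  lo + suc (length (innerSteps ss ++ across ∷ []))                ≡⟨ cong (λ l → lo + suc l) (length-++ (innerSteps ss)) ⟩
  lo + suc (li + 1)                                               ≡⟨ rearrange lo li ⟩
  2 + (lo + li)                                                   ∎
  where
  open ≡-Reasoning
  lo li : ℕ
  lo = length (outerSteps ss)
  li = length (innerSteps ss)
  rearrange : ∀ a b → a + suc (b + 1) ≡ 2 + (a + b)
  rearrange = solve-∀

module _ {n k : ℕ} where

  shift : Step → ℕ
  shift outer⁺ = 1
  shift outer⁻ = n ∸ 1
  shift inner⁺ = k
  shift inner⁻ = n ∸ k
  shift across = 0

  shifts : List Step → ℕ
  shifts ss = sum (map shift ss)

  shifts-partition : ∀ ss → shifts (outerSteps ss) + shifts (innerSteps ss) ≡ shifts ss
  shifts-partition [] = refl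
  shifts-partition (outer⁺ ∷ ss) = trans (+-assoc 1 (shifts (outerSteps ss)) _) (cong (1 +_) (shifts-partition ss))
  shifts-partition (outer⁻ ∷ ss) =
    trans (+-assoc (n ∸ 1) (shifts (outerSteps ss)) _) (cong ((n ∸ 1) +_) (shifts-partition ss))
  shifts-partition (inner⁺ ∷ ss) = trans (x∙yz≈y∙xz (shifts (outerSteps ss)) k _) (cong (k +_) (shifts-partition ss))
  shifts-partition (inner⁻ ∷ ss) =
    trans (x∙yz≈y∙xz (shifts (outerSteps ss)) (n ∸ k) _) (cong ((n ∸ k) +_) (shifts-partition ss))
  shifts-partition (across ∷ ss) = shifts-partition ss

  shifts-++ : ∀ xs ys → shifts (xs ++ ys) ≡ shifts xs + shifts ys
  shifts-++ xs ys = trans (cong sum (map-++ shift xs ys)) (sum-++ (map shift xs) (map shift ys))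

  shifts-twoSpokeSteps : ∀ ss → shifts (twoSpokeSteps ss) ≡ shifts ss
  shifts-twoSpokeSteps ss = begin
    shifts (outerSteps ss ++ across ∷ innerSteps ss ++ across ∷ []) ≡⟨ shifts-++ (outerSteps ss) _ ⟩
    shifts (outerSteps ss) + shifts (innerSteps ss ++ across ∷ [])  ≡⟨ cong (shifts (outerSteps ss) +_) closing ⟩
    shifts (outerSteps ss) + shifts (innerSteps ss)                 ≡⟨ shifts-partition ss ⟩
    shifts ss                                                       ∎
    where
    open ≡-Reasoning
    closing : shifts (innerSteps ss ++ across ∷ []) ≡ shifts (innerSteps ss)
    closing = trans (shifts-++ (innerSteps ss) _) (+-identityʳ _)

  stepOf : ∀ {x y} → Adj n k x y → Step
  stepOf (inj₁ (outer _)) = outer⁺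
  stepOf (inj₂ (outer _)) = outer⁻
  stepOf (inj₁ (inner _)) = inner⁺
  stepOf (inj₂ (inner _)) = inner⁻
  stepOf (inj₁ spoke) = across
  stepOf (inj₂ spoke) = across

  crossing-stepOf : ∀ {x y} (e : Adj n k x y) → crossing (stepOf e) ≡ indicator (proj₁ x xor proj₁ y)
  crossing-stepOf (inj₁ (outer _)) = refl
  crossing-stepOf (inj₂ (outer _)) = refl
  crossing-stepOf (inj₁ (inner _)) = refl
  crossing-stepOf (inj₂ (inner _)) = refl
  crossing-stepOf (inj₁ spoke) = refl
  crossing-stepOf (inj₂ spoke) = refl

  cycleSteps : ∀ {g} → Cycle n k g → List Step
  cycleSteps c = tabulate (λ i → stepOf (adj c i))

  sideChange : ∀ {g} → Cycle n k g → Fin g → ℕ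
  sideChange c i = indicator (proj₁ (vert c i) xor proj₁ (vert c (csuc i)))

  spokeCount≡∑ : ∀ {g} (c : Cycle n k g) → spokeCount c ≡ ∑ (sideChange c)
  spokeCount≡∑ c = trans (cong sum (map-tabulate (λ i → i) (sideChange c))) (sum-tabulate (sideChange c))

  spokes-cycleSteps : ∀ {g} (c : Cycle n k g) → spokes (cycleSteps c) ≡ spokeCount c
  spokes-cycleSteps c = begin
    sum (map crossing (tabulate step))   ≡⟨ cong sum (map-tabulate step crossing) ⟩
    sum (tabulate (λ i → crossing (step i))) ≡⟨ cong sum (tabulate-cong (λ i → crossing-stepOf (adj c i))) ⟩
    sum (tabulate (sideChange c))        ≡⟨ cong sum (map-tabulate (λ i → i) (sideChange c)) ⟨
    spokeCount c                         ∎
    where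
    open ≡-Reasoning
    step : Fin _ → Step
    step i = stepOf (adj c i)

  spokeCount-even : ∀ {g} (c : Cycle n k g) → Even (spokeCount c)
  spokeCount-even c = subst Even (sym (spokeCount≡∑ c)) (∑-changes-even (λ i → proj₁ (vert c i)))

  twoSpoke-shorter : ∀ {g} (c : Cycle n k g) → Odd g → 2 < spokeCount c →
    Odd (length (twoSpokeSteps (cycleSteps c))) × length (twoSpokeSteps (cycleSteps c)) < g
  twoSpoke-shorter {g} c odd-g 2<spokes =
    subst Odd (sym (length-twoSpokeSteps ss))
      (odd-2+ (odd-+-even sideSteps (spokeCount c) (subst Odd (sym total) odd-g) (spokeCount-even c))) ,
    subst₂ _<_ (sym (length-twoSpokeSteps ss)) (trans (+-comm (spokeCount c) sideSteps) total)
      (+-monoˡ-< sideSteps 2<spokes)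
    where
    ss : List Step
    ss = cycleSteps c
    sideSteps : ℕ
    sideSteps = length (outerSteps ss) + length (innerSteps ss)
    total : sideSteps + spokeCount c ≡ g
    total = trans (cong (sideSteps +_) (sym (spokes-cycleSteps c)))
      (trans (length-partition ss) (length-tabulate (λ i → stepOf (adj c i))))

module _ {n k : ℕ} .{{_ : NonZero n}} where

  mod-cong : ∀ {a b} → a % n ≡ b % n → a mod n ≡ b mod n
  mod-cong {a} {b} a≡b = toℕ-injective (trans (toℕ-fromℕ< (m%n<n a n)) (trans a≡b (sym (toℕ-fromℕ< (m%n<n b n)))))

  wrap-around : ∀ p {s} → s ≤ n → (p + (n ∸ s) + s) % n ≡ p % n
  wrap-around p {s} s≤n = trans (cong (_% n) (trans (+-assoc p (n ∸ s) s) (cong (p +_) (m∸n+n≡m s≤n))))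
    ([m+n]%n≡m%n p n)

  -- A walk keeps its index unreduced: it stands at (b , p mod n), and a backward step adds n ∸ 1 or n ∸ k.
  walk : Bool → ℕ → List Step → ℕ → V n
  walk b p ss zero = b , p mod n
  walk b p [] (suc j) = b , p mod n
  walk b p (s ∷ ss) (suc j) = walk (turn s b) (p + shift {n} {k} s) ss j

  walk-end : ∀ {b b′} p ss → Walkable b ss b′ → walk b p ss (length ss) ≡ (b′ , (p + shifts {n} {k} ss) mod n)
  walk-end {b} p [] refl = cong (λ x → b , x mod n) (sym (+-identityʳ p))
  walk-end {b′ = b′} p (s ∷ ss) (_ , walkable) =
    trans (walk-end (p + shift s) ss walkable) (cong (λ x → b′ , x mod n) (+-assoc p (shift s) (shifts ss)))

  module _ (k≤n : k ≤ n) where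

    private
      1≤n : 1 ≤ n
      1≤n = >-nonZero⁻¹ n

    shift-ShiftBy : ∀ {x y} (e : Adj n k x y) → ShiftBy n (shift {n} {k} (stepOf e)) (proj₂ x) (proj₂ y)
    shift-ShiftBy (inj₁ (outer i+1≡j)) = i+1≡j
    shift-ShiftBy (inj₂ (outer j+1≡i)) = ShiftBy-reverse 1≤n j+1≡i
    shift-ShiftBy (inj₁ (inner i+k≡j)) = i+k≡j
    shift-ShiftBy (inj₂ (inner j+k≡i)) = ShiftBy-reverse k≤n j+k≡i
    shift-ShiftBy (inj₁ (spoke {i})) = 0 , +-identityʳ (toℕ i)
    shift-ShiftBy (inj₂ (spoke {i})) = 0 , +-identityʳ (toℕ i)

    n∣shifts-cycleSteps : ∀ {g} (c : Cycle n k g) → n ∣ shifts {n} {k} (cycleSteps c)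
    n∣shifts-cycleSteps c = subst (n ∣_) (sym shifts≡∑)
      (∑-shifts-divisible (λ i → proj₂ (vert c i)) (λ i → shift (step i)) (λ i → shift-ShiftBy (adj c i)))
      where
      step : Fin _ → Step
      step i = stepOf (adj c i)
      shifts≡∑ : shifts (tabulate step) ≡ ∑ (λ i → shift (step i))
      shifts≡∑ = trans (cong sum (map-tabulate step shift)) (sum-tabulate (λ i → shift (step i)))

    step-adj : ∀ {b} s p → Legal b s → Adj n k (b , p mod n) (turn s b , (p + shift {n} {k} s) mod n)
    step-adj {false} outer⁺ p _ = inj₁ (outer (mod-ShiftBy 1 refl))
    step-adj {false} outer⁻ p _ = inj₂ (outer (mod-ShiftBy 1 (wrap-around p 1≤n)))
    step-adj {true} inner⁺ p _ = inj₁ (inner (mod-ShiftBy k refl))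
    step-adj {true} inner⁻ p _ = inj₂ (inner (mod-ShiftBy k (wrap-around p k≤n)))
    step-adj {false} across p _ rewrite +-identityʳ p = inj₁ spoke
    step-adj {true} across p _ rewrite +-identityʳ p = inj₂ spoke

    walk-adj : ∀ {b b′} p ss → Walkable b ss b′ →
      ∀ j → j < length ss → Adj n k (walk b p ss j) (walk b p ss (suc j))
    walk-adj p (s ∷ ss) (legal , _) zero _ = step-adj s p legal
    walk-adj p (s ∷ ss) (_ , walkable) (suc j) (s≤s j<l) = walk-adj (p + shift s) ss walkable j j<l

    twoSpoke-closed : ∀ ss → n ∣ shifts {n} {k} ss →
      ClosedWalk n k (length (twoSpokeSteps ss)) (walk false 0 (twoSpokeSteps ss))
    twoSpoke-closed ss n∣shifts = returns , walk-adj 0 (twoSpokeSteps ss) (Walkable-twoSpokeSteps ss)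
      where
      returns : walk false 0 (twoSpokeSteps ss) (length (twoSpokeSteps ss)) ≡ (false , 0 mod n)
      returns = trans (walk-end 0 (twoSpokeSteps ss) (Walkable-twoSpokeSteps ss))
        (cong (false ,_) (mod-cong (trans (n∣m⇒m%n≡0 _ n (subst (n ∣_) (sym (shifts-twoSpokeSteps ss)) n∣shifts))
          (sym (m*n%n≡0 0 n)))))

    spokeCount≤2 : (∀ x → ¬ Adj n k x x) → ∀ {g} → Odd g → (∀ L → Odd L → Cycle n k L → g ≤ L) →
      (c : Cycle n k g) → spokeCount c ≤ 2
    spokeCount≤2 loopless odd-g shortest c with spokeCount c ≤? 2
    ... | yes ≤2 = ≤2
    ... | no ≰2 with twoSpoke-shorter c odd-g (≰⇒> ≰2)
    ...   | odd-W , W<g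
      with oddCycleWithin loopless _ odd-W _ (twoSpoke-closed (cycleSteps c) (n∣shifts-cycleSteps c))
    ...   | L , odd-L , L≤W , cycle = contradiction (shortest L odd-L cycle) (<⇒≱ (≤-<-trans L≤W W<g))

lemma2p7 : (n k g : ℕ) → 0 < k → 2 * k < n → ¬ Bipartite n k →
    IsOddGirth n k g → (c : Cycle n k g) → spokeCount c ≤ 2
lemma2p7 (suc n′) k g 0<k 2k<n _ (odd-g , _ , shortest) =
  spokeCount≤2 (<⇒≤ k<n) (Adj-irrefl 0<k k<n 1<n) odd-g shortest
  where
  k<n : k < suc n′
  k<n = ≤-<-trans (m≤m+n k (k + 0)) 2k<n
  1<n : 1 < suc n′
  1<n = ≤-trans (*-monoʳ-≤ 2 0<k) (<⇒≤ 2k<n)
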